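{- Let $S_n=\{P_n(2,a,b)\mid a+b=n-3,\ 1\le a\le b\}$, and write $P_n(2,a,*)$ for $P_n(2,a,n-3-a)$. Let $k=\lfloor\frac{n-3}{2}\rfloor$, $t=\lfloor\frac{k}{2}\rfloor$ and $l=\lfloor\frac{k-1}{2}\rfloor$. Then the trees of $S_n$ are totally ordered as $$P_n(2,2,*)\succ P_n(2,4,*)\succ\cdots\succ P_n(2,2t,*)\succ P_n(2,2l+1,*)\succ\cdots\succ P_n(2,3,*)\succ P_n(2,1,*).$$
   Context: $P_n(a_1,\dots,a_k)$ ($k\ge3$, $a_i\ge1$, $\sum a_i=n-1$) is the tree of order $n$ consisting of a central vertex with $k$ internally disjoint pendent paths of lengths $a_1,\dots,a_k$. For trees $T_1,T_2$ of the same order, $T_1\prec T_2$ (equivalently $T_2\succ T_1$) means $m(T_1,i)\le m(T_2,i)$ for all $i$ with strict inequality for some $i$, where $m(T,i)$ is the number of $i$-matchings of $T$ (these are the absolute values of the coefficients of the characteristic polynomial of the adjacency matrix). -}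

module Defs where

open import Data.Nat using (ℕ; zero; suc; _+_; _*_; _∸_; _≤_; _<_; _/_; _≡ᵇ_)
open import Data.Bool using (Bool; true; false; _∧_; _∨_; not; T)
open import Data.Product using (_×_; _,_; ∃)
open import Data.List using (List; []; _∷_; _++_; length; filter; map; upTo; reverse; concatMap)
open import Data.List.Relation.Unary.Linked using (Linked)
open import Relation.Nullary.Decidable using (T?)

-- An edge is an unordered pair of vertex labels (vertices are natural numbers).
Edge : Set
Edge = ℕ × ℕ

Tree : Set
Tree = List Edge

pathEdges : ℕ → ℕ → ℕ → List Edge
pathEdges u v zero    = []
pathEdges u v (suc a) = (u , v) ∷ pathEdges v (suc v) a

spiderEdges′ : ℕ → List ℕ → List Edge
spiderEdges′ v []       = []
spiderEdges′ v (a ∷ as) = pathEdges 0 v a ++ spiderEdges′ (v + a) as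

-- P_n(a_1,...,a_k): central vertex 0 with pendent paths of lengths a_1..a_k;
-- its vertex set is {0,...,n-1} where n = 1 + Σ a_i.
P : List ℕ → Tree
P as = spiderEdges′ 1 as

sublists : {A : Set} → List A → List (List A)
sublists []       = [] ∷ []
sublists (x ∷ xs) = let r = sublists xs in r ++ map (x ∷_) r

disjointᵇ : Edge → Edge → Bool
disjointᵇ (a , b) (c , d) = not ((a ≡ᵇ c) ∨ (a ≡ᵇ d) ∨ (b ≡ᵇ c) ∨ (b ≡ᵇ d))

isMatchingᵇ : List Edge → Bool
isMatchingᵇ []       = true
isMatchingᵇ (e ∷ es) = allᵇ es ∧ isMatchingᵇ es
  where
  allᵇ : List Edge → Bool
  allᵇ []       = true
  allᵇ (f ∷ fs) = disjointᵇ e f ∧ allᵇ fs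

m : Tree → ℕ → ℕ
m T i = length (filter (λ M → T? (isMatchingᵇ M ∧ (length M ≡ᵇ i))) (sublists T))

_≺_ : Tree → Tree → Set
T₁ ≺ T₂ = (∀ i → m T₁ i ≤ m T₂ i) × ∃ (λ i → m T₁ i < m T₂ i)

_≻_ : Tree → Tree → Set
T₁ ≻ T₂ = T₂ ≺ T₁

P2 : ℕ → ℕ → Tree
P2 n a = P (2 ∷ a ∷ (n ∸ 3 ∸ a) ∷ [])

-- The sequence of values of a in the claimed order:
-- 2, 4, ..., 2t, 2l+1, ..., 3, 1  with k = ⌊(n-3)/2⌋, t = ⌊k/2⌋, l = ⌊(k-1)/2⌋.
chainIndices : ℕ → List ℕ
chainIndices n =
  let k = (n ∸ 3) / 2
      t = k / 2
      l = (k ∸ 1) / 2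
  in map (λ j → 2 * suc j) (upTo t) ++ map (λ j → suc (2 * j)) (reverse (upTo (suc l)))

-- Deleting the centre edge of the arm of length 2, and using that the remaining two arms form
-- a path, one gets for a + b = n - 3
--   m(P_n(2,a,b), i+1) = [xⁱ⁺¹] g(n-2) + [xⁱ] g(n-2) + [xⁱ] g(a) g(b),
-- where g(c) is the matching polynomial ∑ m(P_c, i) xⁱ of the path on c vertices.  So the
-- trees of S_n are ordered like the products g(a) g(b), coefficientwise.  These are compared by
--   g(a) g(b) − g(a+1) g(b-1) = (−1)ᵃ xᵃ⁺¹ g(b-a-2),
-- proved by induction from g(c+2) = g(c+1) + x g(c): moving an even a up by two, or an odd a
-- down by two, strictly decreases the product, and at the middle of the chain the same
-- identity compares the two neighbouring values of a.

module Submission where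

open import Defs
import Algebra.Properties.CommutativeSemigroup as CommSemigroupProperties
open import Data.Bool using (Bool; true; false; _∧_; T)
open import Data.Bool.ListAction using (all)
open import Data.Bool.Properties using (∧-assoc; ∧-zeroʳ; ∧-identityʳ; ∨-zeroʳ)
open import Data.List using (List; []; _∷_; _++_; length; map; filterᵇ; upTo; downFrom; reverse; applyUpTo; applyDownFrom)
open import Data.List.Properties using (length-++; filter-++; filter-all; map-cong; map-upTo; map-downFrom; reverse-upTo)
open import Data.List.Relation.Unary.All as All using (All; []; _∷_)
import Data.List.Relation.Unary.All.Properties as All
open import Data.List.Relation.Unary.Linked using (Linked; [-]; _∷_)
open import Data.List.Relation.Unary.Linked.Properties using (applyDownFrom⁺₁)
open import Data.Nat using (ℕ; zero; suc; _+_; _*_; _∸_; _/_; _≡ᵇ_; _<_; _≤_; z≤n; z<s; s≤s)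
open import Data.Nat.DivMod using (m/n≡1+[m∸n]/n; m/n*n≤m; m≥n⇒m/n>0)
open import Data.Nat.Properties
open import Data.Nat.Tactic.RingSolver using (solve-∀)
open import Data.Product using (_,_; _×_; proj₁; proj₂; ∃)
open import Data.Sum using (_⊎_; inj₁; inj₂)
open import Function using (_∘_)
open import Relation.Binary.PropositionalEquality
open import Relation.Nullary using (contradiction)
open import Relation.Nullary.Decidable using (T?)

open CommSemigroupProperties +-commutativeSemigroup using (interchange; xy∙z≈xz∙y; x∙yz≈xz∙y)

-- Counting matchings

count : {A : Set} → (A → Bool) → List A → ℕ
count p = length ∘ filterᵇ p

module _ {A : Set} where

  count-++ : ∀ (p : A → Bool) xs ys → count p (xs ++ ys) ≡ count p xs + count p ys
  count-++ p xs ys = trans (cong length (filter-++ _ xs ys)) (length-++ (filterᵇ p xs))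

  count-map : ∀ {B : Set} (p : B → Bool) (f : A → B) xs → count p (map f xs) ≡ count (p ∘ f) xs
  count-map p f [] = refl
  count-map p f (x ∷ xs) with p (f x)
  ... | true  = cong suc (count-map p f xs)
  ... | false = count-map p f xs

  count-cong : ∀ {p q : A → Bool} → p ≗ q → ∀ xs → count p xs ≡ count q xs
  count-cong p≗q [] = refl
  count-cong {p} {q} p≗q (x ∷ xs) with p x | q x | p≗q x
  ... | true  | .true  | refl = cong suc (count-cong p≗q xs)
  ... | false | .false | refl = count-cong p≗q xs

  count-none : ∀ {p : A → Bool} → (∀ x → p x ≡ false) → ∀ xs → count p xs ≡ 0
  count-none none [] = refl
  count-none none (x ∷ xs) rewrite none x = count-none none xs

count-sublists-∷ : ∀ {A : Set} (p : List A → Bool) x xs →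
  count p (sublists (x ∷ xs)) ≡ count p (sublists xs) + count (p ∘ (x ∷_)) (sublists xs)
count-sublists-∷ p x xs =
  trans (count-++ p (sublists xs) _) (cong (count p (sublists xs) +_) (count-map p (x ∷_) (sublists xs)))

count-sublists-all : ∀ {A : Set} (p : A → Bool) (q : List A → Bool) xs →
  count (λ M → all p M ∧ q M) (sublists xs) ≡ count q (sublists (filterᵇ p xs))
count-sublists-all p q [] with q []
... | true  = refl
... | false = refl
count-sublists-all p q (x ∷ xs) with p x in px
... | true = begin
  count φ (sublists (x ∷ xs))
    ≡⟨ count-sublists-∷ φ x xs ⟩
  count φ (sublists xs) + count (φ ∘ (x ∷_)) (sublists xs)
    ≡⟨ cong₂ _+_ (count-sublists-all p q xs) (count-cong (λ M → cong (λ b → (b ∧ all p M) ∧ q (x ∷ M)) px) (sublists xs)) ⟩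
  count q S + count (λ M → all p M ∧ q (x ∷ M)) (sublists xs)
    ≡⟨ cong (count q S +_) (count-sublists-all p (q ∘ (x ∷_)) xs) ⟩
  count q S + count (q ∘ (x ∷_)) S
    ≡⟨ count-sublists-∷ q x (filterᵇ p xs) ⟨
  count q (sublists (x ∷ filterᵇ p xs)) ∎
  where
  open ≡-Reasoning
  φ = λ M → all p M ∧ q M
  S = sublists (filterᵇ p xs)
... | false = begin
  count φ (sublists (x ∷ xs))
    ≡⟨ count-sublists-∷ φ x xs ⟩
  count φ (sublists xs) + count (φ ∘ (x ∷_)) (sublists xs)
    ≡⟨ cong₂ _+_ (count-sublists-all p q xs) (count-none (λ M → cong (λ b → (b ∧ all p M) ∧ q (x ∷ M)) px) (sublists xs)) ⟩
  count q (sublists (filterᵇ p xs)) + 0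
    ≡⟨ +-identityʳ _ ⟩
  count q (sublists (filterᵇ p xs)) ∎
  where
  open ≡-Reasoning
  φ = λ M → all p M ∧ q M

-- With this, m T i is definitionally count (isMatching i) (sublists T).
isMatching : ℕ → List Edge → Bool
isMatching i M = isMatchingᵇ M ∧ (length M ≡ᵇ i)

-- isMatchingᵇ tests e against M with a helper local to Defs, reachable only through
-- isMatchingᵇ (e ∷ M) itself; hence the induction keeps the conjunction with isMatchingᵇ M.
isMatchingᵇ-∷ : ∀ e M → isMatchingᵇ (e ∷ M) ≡ all (disjointᵇ e) M ∧ isMatchingᵇ M
isMatchingᵇ-∷ e [] = refl
isMatchingᵇ-∷ e (f ∷ M) = step (disjointᵇ e f) _ _ _ (isMatchingᵇ M) (isMatchingᵇ-∷ e M)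
  where
  step : ∀ d a a′ s r → a ∧ r ≡ a′ ∧ r → (d ∧ a) ∧ (s ∧ r) ≡ (d ∧ a′) ∧ (s ∧ r)
  step d a a′ s false _ rewrite ∧-zeroʳ s | ∧-zeroʳ (d ∧ a) | ∧-zeroʳ (d ∧ a′) = refl
  step d a a′ s true eq rewrite ∧-identityʳ a | ∧-identityʳ a′ | eq = refl

m-zero : ∀ T → m T 0 ≡ 1
m-zero [] = refl
m-zero (e ∷ T) = begin
  m (e ∷ T) 0
    ≡⟨ count-sublists-∷ (isMatching 0) e T ⟩
  m T 0 + count (isMatching 0 ∘ (e ∷_)) (sublists T)
    ≡⟨ cong₂ _+_ (m-zero T) (count-none (λ M → ∧-zeroʳ (isMatchingᵇ (e ∷ M))) (sublists T)) ⟩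
  1 ∎
  where open ≡-Reasoning

-- Deleting an edge e: the (i+1)-matchings either avoid e, or consist of e together
-- with an i-matching of the edges disjoint from e.
m-delete : ∀ e T i → m (e ∷ T) (suc i) ≡ m T (suc i) + m (filterᵇ (disjointᵇ e) T) i
m-delete e T i = begin
  m (e ∷ T) (suc i)
    ≡⟨ count-sublists-∷ (isMatching (suc i)) e T ⟩
  m T (suc i) + count (isMatching (suc i) ∘ (e ∷_)) (sublists T)
    ≡⟨ cong (m T (suc i) +_) (count-cong containing-e (sublists T)) ⟩
  m T (suc i) + count (λ M → all (disjointᵇ e) M ∧ isMatching i M) (sublists T)
    ≡⟨ cong (m T (suc i) +_) (count-sublists-all (disjointᵇ e) (isMatching i) T) ⟩
  m T (suc i) + m (filterᵇ (disjointᵇ e) T) i ∎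
  where
  open ≡-Reasoning
  containing-e : ∀ M → isMatching (suc i) (e ∷ M) ≡ all (disjointᵇ e) M ∧ isMatching i M
  containing-e M = trans (cong (_∧ (length M ≡ᵇ i)) (isMatchingᵇ-∷ e M)) (∧-assoc (all (disjointᵇ e) M) (isMatchingᵇ M) (length M ≡ᵇ i))

-- Polynomials over ℕ

-- Coefficient sequences, compared with _≗_; shift multiplies by x.
Poly : Set
Poly = ℕ → ℕ

infixl 6 _⊕_

_⊕_ : Poly → Poly → Poly
(f ⊕ h) i = f i + h i

one : Poly
one zero    = 1
one (suc i) = 0

shift : Poly → Poly
shift f zero    = 0
shift f (suc i) = f i

shiftBy : ℕ → Poly → Poly
shiftBy zero    f = f
shiftBy (suc j) f = shift (shiftBy j f)

-- pathMul c f is f times the matching polynomial of the path on c vertices, defined by the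
-- recurrence p(c+2) = p(c+1) + x p(c) of those polynomials, so that no convolution is needed.
pathMul : ℕ → Poly → Poly
pathMul zero          f = f
pathMul (suc zero)    f = f
pathMul (suc (suc c)) f = pathMul (suc c) f ⊕ shift (pathMul c f)

pathPoly : ℕ → Poly
pathPoly c = pathMul c one

⊕-cong : ∀ {f f′ h h′} → f ≗ f′ → h ≗ h′ → f ⊕ h ≗ f′ ⊕ h′
⊕-cong f≗f′ h≗h′ i = cong₂ _+_ (f≗f′ i) (h≗h′ i)

shift-cong : ∀ {f h} → f ≗ h → shift f ≗ shift h
shift-cong f≗h zero    = refl
shift-cong f≗h (suc i) = f≗h i

shift-⊕ : ∀ f h → shift (f ⊕ h) ≗ shift f ⊕ shift h
shift-⊕ f h zero    = refl
shift-⊕ f h (suc i) = refl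

shiftBy-⊕ : ∀ j f h → shiftBy j (f ⊕ h) ≗ shiftBy j f ⊕ shiftBy j h
shiftBy-⊕ zero    f h = λ _ → refl
shiftBy-⊕ (suc j) f h i = trans (shift-cong (shiftBy-⊕ j f h) i) (shift-⊕ (shiftBy j f) (shiftBy j h) i)

shiftBy-diag : ∀ j f → shiftBy j f j ≡ f 0
shiftBy-diag zero    f = refl
shiftBy-diag (suc j) f = shiftBy-diag j f

pathMul-cong : ∀ c {f h} → f ≗ h → pathMul c f ≗ pathMul c h
pathMul-cong zero          f≗h = f≗h
pathMul-cong (suc zero)    f≗h = f≗h
pathMul-cong (suc (suc c)) f≗h = ⊕-cong (pathMul-cong (suc c) f≗h) (shift-cong (pathMul-cong c f≗h))

pathMul-zero : ∀ c f → pathMul c f 0 ≡ f 0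
pathMul-zero zero          f = refl
pathMul-zero (suc zero)    f = refl
pathMul-zero (suc (suc c)) f = trans (+-comm _ 0) (pathMul-zero (suc c) f)

pathPoly-zero : ∀ c → pathPoly c 0 ≡ 1
pathPoly-zero c = pathMul-zero c one

pathMul-⊕ : ∀ c f h → pathMul c (f ⊕ h) ≗ pathMul c f ⊕ pathMul c h
pathMul-⊕ zero          f h = λ _ → refl
pathMul-⊕ (suc zero)    f h = λ _ → refl
pathMul-⊕ (suc (suc c)) f h i = begin
  pathMul (suc c) (f ⊕ h) i + shift (pathMul c (f ⊕ h)) i
    ≡⟨ ⊕-cong (pathMul-⊕ (suc c) f h) (λ i → trans (shift-cong (pathMul-⊕ c f h) i) (shift-⊕ _ _ i)) i ⟩
  (F₁ i + H₁ i) + (shift F₀ i + shift H₀ i)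
    ≡⟨ interchange (F₁ i) (H₁ i) (shift F₀ i) (shift H₀ i) ⟩
  (F₁ i + shift F₀ i) + (H₁ i + shift H₀ i) ∎
  where
  open ≡-Reasoning
  F₁ = pathMul (suc c) f
  H₁ = pathMul (suc c) h
  F₀ = pathMul c f
  H₀ = pathMul c h

pathMul-shift : ∀ c f → pathMul c (shift f) ≗ shift (pathMul c f)
pathMul-shift zero          f = λ _ → refl
pathMul-shift (suc zero)    f = λ _ → refl
pathMul-shift (suc (suc c)) f i = begin
  pathMul (suc c) (shift f) i + shift (pathMul c (shift f)) i
    ≡⟨ ⊕-cong (pathMul-shift (suc c) f) (shift-cong (pathMul-shift c f)) i ⟩
  shift (pathMul (suc c) f) i + shift (shift (pathMul c f)) i
    ≡⟨ shift-⊕ (pathMul (suc c) f) (shift (pathMul c f)) i ⟨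
  shift (pathMul (suc (suc c)) f) i ∎
  where open ≡-Reasoning

pathMul-⊕-shift : ∀ c f h → pathMul c (f ⊕ shift h) ≗ pathMul c f ⊕ shift (pathMul c h)
pathMul-⊕-shift c f h i =
  trans (pathMul-⊕ c f (shift h) i) (cong (pathMul c f i +_) (pathMul-shift c h i))

pathPoly-join : ∀ a b →
  pathMul (suc a) (pathPoly (suc b)) ⊕ shift (pathMul a (pathPoly b)) ≗ pathPoly (suc (suc (a + b)))
pathPoly-join zero    b i = refl
pathPoly-join (suc a) b i = begin
  (A i + shift B i) + shift C i   ≡⟨ xy∙z≈xz∙y (A i) (shift B i) (shift C i) ⟩
  (A i + shift C i) + shift B i   ≡⟨ cong (_+ shift B i) (pathMul-⊕-shift (suc a) _ _ i) ⟨
  pathMul (suc a) (pathPoly (suc (suc b))) i + shift B i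
                                  ≡⟨ pathPoly-join a (suc b) i ⟩
  pathPoly (suc (suc (a + suc b))) i
                                  ≡⟨ cong (λ c → pathPoly (suc (suc c)) i) (+-suc a b) ⟩
  pathPoly (suc (suc (suc a + b))) i ∎
  where
  open ≡-Reasoning
  A = pathMul (suc a) (pathPoly (suc b))
  B = pathMul a (pathPoly (suc b))
  C = pathMul (suc a) (pathPoly b)

double : ℕ → ℕ
double zero    = zero
double (suc j) = suc (suc (double j))

-- With g = pathPoly: g(a) g(a+d+2) − g(a+1) g(a+d+1) = (−1)ᵃ xᵃ⁺¹ g(d); over ℕ the parity of a
-- decides on which side xᵃ⁺¹ g(d) stands.
pathPoly-exchange-even : ∀ j d →
  pathMul (double j) (pathPoly (suc (suc (double j)) + d))
    ≗ pathMul (suc (double j)) (pathPoly (suc (double j) + d)) ⊕ shiftBy (suc (double j)) (pathPoly d)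
pathPoly-exchange-odd : ∀ j d →
  pathMul (suc (suc (double j))) (pathPoly (suc (suc (double j)) + d))
    ≗ pathMul (suc (double j)) (pathPoly (suc (suc (suc (double j))) + d)) ⊕ shiftBy (suc (suc (double j))) (pathPoly d)

pathPoly-exchange-even zero    d i = refl
pathPoly-exchange-even (suc j) d i = begin
  pathMul a (pathPoly (suc a + d) ⊕ shift (pathPoly (a + d))) i
    ≡⟨ pathMul-⊕-shift a _ _ i ⟩
  pathMul a (pathPoly (suc a + d)) i + shift (pathMul a (pathPoly (a + d))) i
    ≡⟨ cong (pathMul a (pathPoly (suc a + d)) i +_)
         (trans (shift-cong (pathPoly-exchange-odd j d) i) (shift-⊕ _ _ i)) ⟩
  pathMul a (pathPoly (suc a + d)) i
    + (shift (pathMul (suc e) (pathPoly (suc a + d))) i + shiftBy (suc a) (pathPoly d) i)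
    ≡⟨ +-assoc (pathMul a (pathPoly (suc a + d)) i) _ (shiftBy (suc a) (pathPoly d) i) ⟨
  pathMul (suc a) (pathPoly (suc a + d)) i + shiftBy (suc a) (pathPoly d) i ∎
  where
  open ≡-Reasoning
  e = double j
  a = suc (suc e)

pathPoly-exchange-odd j d i = begin
  pathMul a (pathPoly (suc a + d)) i + shift (pathMul e (pathPoly (suc a + d))) i
    ≡⟨ cong (pathMul a (pathPoly (suc a + d)) i +_)
         (trans (shift-cong (pathPoly-exchange-even j d) i) (shift-⊕ _ _ i)) ⟩
  pathMul a (pathPoly (suc a + d)) i
    + (shift (pathMul a (pathPoly (a + d))) i + shiftBy (suc a) (pathPoly d) i)
    ≡⟨ +-assoc (pathMul a (pathPoly (suc a + d)) i) _ (shiftBy (suc a) (pathPoly d) i) ⟨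
  (pathMul a (pathPoly (suc a + d)) i + shift (pathMul a (pathPoly (a + d))) i)
    + shiftBy (suc a) (pathPoly d) i
    ≡⟨ cong (_+ shiftBy (suc a) (pathPoly d) i) (pathMul-⊕-shift a _ _ i) ⟨
  pathMul a (pathPoly (suc (suc a) + d)) i + shiftBy (suc a) (pathPoly d) i ∎
  where
  open ≡-Reasoning
  e = double j
  a = suc e

shiftBy-shift : ∀ j f → shiftBy j (shift f) ≗ shift (shiftBy j f)
shiftBy-shift zero    f = λ _ → refl
shiftBy-shift (suc j) f = shift-cong (shiftBy-shift j f)

shiftBy-pathPoly : ∀ a c →
  shiftBy (suc a) (pathPoly (suc (suc c))) ≗ shiftBy (suc a) (pathPoly (suc c)) ⊕ shiftBy (suc (suc a)) (pathPoly c)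
shiftBy-pathPoly a c i =
  trans (shiftBy-⊕ (suc a) _ _ i) (cong (shiftBy (suc a) (pathPoly (suc c)) i +_) (shiftBy-shift (suc a) (pathPoly c) i))

[1+a]+[2+c]≡[3+a]+c : ∀ a c → suc a + suc (suc c) ≡ suc (suc (suc a)) + c
[1+a]+[2+c]≡[3+a]+c a c = cong suc (trans (+-suc a (suc c)) (cong suc (+-suc a c)))

pathPoly-step-even : ∀ j c → let a = double j in
  pathMul a (pathPoly (suc (suc a) + suc (suc c)))
    ≗ pathMul (suc (suc a)) (pathPoly (suc (suc a) + c)) ⊕ shiftBy (suc a) (pathPoly (suc c))
pathPoly-step-even j c i = begin
  pathMul a (pathPoly (suc (suc a) + suc (suc c))) i
    ≡⟨ pathPoly-exchange-even j (suc (suc c)) i ⟩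
  pathMul (suc a) (pathPoly (suc a + suc (suc c))) i + shiftBy (suc a) (pathPoly (suc (suc c))) i
    ≡⟨ cong₂ _+_ (cong (λ k → pathMul (suc a) (pathPoly k) i) ([1+a]+[2+c]≡[3+a]+c a c)) (shiftBy-pathPoly a c i) ⟩
  M + (U + V)
    ≡⟨ x∙yz≈xz∙y M U V ⟩
  (M + V) + U
    ≡⟨ cong (_+ U) (pathPoly-exchange-odd j c i) ⟨
  pathMul (suc (suc a)) (pathPoly (suc (suc a) + c)) i + U ∎
  where
  open ≡-Reasoning
  a = double j
  M = pathMul (suc a) (pathPoly (suc (suc (suc a)) + c)) i
  U = shiftBy (suc a) (pathPoly (suc c)) i
  V = shiftBy (suc (suc a)) (pathPoly c) i

pathPoly-step-odd : ∀ j c → let a = suc (double j) in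
  pathMul (suc (suc a)) (pathPoly (suc (suc a) + c))
    ≗ pathMul a (pathPoly (suc (suc a) + suc (suc c))) ⊕ shiftBy (suc a) (pathPoly (suc c))
pathPoly-step-odd j c i = +-cancelʳ-≡ V _ _ (begin
  pathMul (suc (suc a)) (pathPoly (suc (suc a) + c)) i + V
    ≡⟨ pathPoly-exchange-even (suc j) c i ⟨
  pathMul (suc a) (pathPoly (suc (suc (suc a)) + c)) i
    ≡⟨ cong (λ k → pathMul (suc a) (pathPoly k) i) ([1+a]+[2+c]≡[3+a]+c a c) ⟨
  pathMul (suc a) (pathPoly (suc a + suc (suc c))) i
    ≡⟨ pathPoly-exchange-odd j (suc (suc c)) i ⟩
  L + shiftBy (suc a) (pathPoly (suc (suc c))) i
    ≡⟨ cong (L +_) (shiftBy-pathPoly a c i) ⟩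
  L + (U + V)
    ≡⟨ +-assoc L U V ⟨
  (L + U) + V ∎)
  where
  open ≡-Reasoning
  a = suc (double j)
  L = pathMul a (pathPoly (suc (suc a) + suc (suc c))) i
  U = shiftBy (suc a) (pathPoly (suc c)) i
  V = shiftBy (suc (suc a)) (pathPoly c) i

-- Matching polynomials of paths and of P_n(2,a,b)

Avoids : ℕ → List Edge → Set
Avoids x = All (λ e → x ≢ proj₁ e × x ≢ proj₂ e)

≢⇒≡ᵇ-false : ∀ {m n} → m ≢ n → (m ≡ᵇ n) ≡ false
≢⇒≡ᵇ-false {m} {n} m≢n with m ≡ᵇ n in eq
... | false = refl
... | true  = contradiction (≡ᵇ⇒≡ m n (subst T (sym eq) _)) m≢n

≡ᵇ-refl : ∀ n → (n ≡ᵇ n) ≡ true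
≡ᵇ-refl zero    = refl
≡ᵇ-refl (suc n) = ≡ᵇ-refl n

disjointᵇ-adjacent : ∀ u v w → disjointᵇ (u , v) (v , w) ≡ false
disjointᵇ-adjacent u v w rewrite ≡ᵇ-refl v | ∨-zeroʳ (u ≡ᵇ w) | ∨-zeroʳ (u ≡ᵇ v) = refl

disjointᵇ-avoiding : ∀ {x y} e → (x ≢ proj₁ e × x ≢ proj₂ e) × (y ≢ proj₁ e × y ≢ proj₂ e) →
                     T (disjointᵇ (x , y) e)
disjointᵇ-avoiding (p , q) ((x≢p , x≢q) , (y≢p , y≢q))
  rewrite ≢⇒≡ᵇ-false x≢p | ≢⇒≡ᵇ-false x≢q | ≢⇒≡ᵇ-false y≢p | ≢⇒≡ᵇ-false y≢q = _

filter-avoided : ∀ {x y} E → Avoids x E → Avoids y E → filterᵇ (disjointᵇ (x , y)) E ≡ E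
filter-avoided {x} {y} E x∉E y∉E = filter-all (T? ∘ disjointᵇ (x , y)) (All.zipWith (disjointᵇ-avoiding _) (x∉E , y∉E))

-- c counts vertices: the path v, v+1, …, v+c-1.
pathFrom : ℕ → ℕ → List Edge
pathFrom v zero    = []
pathFrom v (suc c) = pathEdges v (suc v) c

avoids-pathEdges : ∀ {x u v} c → x ≢ u → x < v → Avoids x (pathEdges u v c)
avoids-pathEdges zero    x≢u x<v = []
avoids-pathEdges (suc c) x≢u x<v = (x≢u , <⇒≢ x<v) ∷ avoids-pathEdges c (<⇒≢ x<v) (m<n⇒m<1+n x<v)

avoids-pathFrom : ∀ {x v} c → x < v → Avoids x (pathFrom v c)
avoids-pathFrom zero    x<v = []
avoids-pathFrom (suc c) x<v = avoids-pathEdges c (<⇒≢ x<v) (m<n⇒m<1+n x<v)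

filter-pathEdges : ∀ {x y} u w c → disjointᵇ (x , y) (u , w) ≡ false → x < w → y < w →
                   filterᵇ (disjointᵇ (x , y)) (pathEdges u w c) ≡ pathFrom w c
filter-pathEdges u w zero    _   _   _   = refl
filter-pathEdges u w (suc c) hit x<w y<w rewrite hit =
  filter-avoided (pathFrom w (suc c)) (avoids-pathFrom (suc c) x<w) (avoids-pathFrom (suc c) y<w)

AvoidsRange : ℕ → ℕ → List Edge → Set
AvoidsRange v c E = ∀ {x} → v ≤ x → x < v + c → Avoids x E

AvoidsRange-head : ∀ {v c E} → AvoidsRange v (suc c) E → Avoids v E
AvoidsRange-head {v} r = r ≤-refl (m<m+n v z<s)

AvoidsRange-tail : ∀ {v c E} → AvoidsRange v (suc c) E → AvoidsRange (suc v) c E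
AvoidsRange-tail {v} {c} r {x} v<x x<v+c = r (<⇒≤ v<x) (subst (x <_) (sym (+-suc v c)) x<v+c)

m-ext : ∀ T {f : Poly} → f 0 ≡ 1 → (∀ i → m T (suc i) ≡ f (suc i)) → m T ≗ f
m-ext T f0 m≡f zero    = trans (m-zero T) (sym f0)
m-ext T f0 m≡f (suc i) = m≡f i

m-[] : m [] ≗ one
m-[] zero    = refl
m-[] (suc i) = refl

m-pathEdges-++ : ∀ c {u v E} → u < v → Avoids u E → AvoidsRange v c E →
                 m (pathEdges u v c ++ E) ≗ pathMul (suc c) (m E)
m-pathFrom-++ : ∀ c {v E} → AvoidsRange v c E → m (pathFrom v c ++ E) ≗ pathMul c (m E)

m-pathEdges-++ zero    _ _ _ _ = refl
m-pathEdges-++ (suc c) {u} {v} {E} u<v u∉E r =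
  m-ext (pathEdges u v (suc c) ++ E) (trans (pathMul-zero (suc (suc c)) (m E)) (m-zero E)) λ i → begin
    m ((u , v) ∷ rest) (suc i)
      ≡⟨ m-delete (u , v) rest i ⟩
    m rest (suc i) + m (filterᵇ (disjointᵇ (u , v)) rest) i
      ≡⟨ cong₂ _+_ (m-pathEdges-++ c (n<1+n v) v∉E (AvoidsRange-tail r) (suc i)) (cong (λ T → m T i) removed) ⟩
    pathMul (suc c) (m E) (suc i) + m (pathFrom (suc v) c ++ E) i
      ≡⟨ cong (pathMul (suc c) (m E) (suc i) +_) (m-pathFrom-++ c (AvoidsRange-tail r) i) ⟩
    pathMul (suc c) (m E) (suc i) + pathMul c (m E) i ∎
  where
  open ≡-Reasoning
  rest = pathEdges v (suc v) c ++ E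
  v∉E = AvoidsRange-head r
  removed : filterᵇ (disjointᵇ (u , v)) rest ≡ pathFrom (suc v) c ++ E
  removed = trans (filter-++ (T? ∘ disjointᵇ (u , v)) (pathEdges v (suc v) c) E)
    (cong₂ _++_ (filter-pathEdges v (suc v) c (disjointᵇ-adjacent u v (suc v)) (m<n⇒m<1+n u<v) (n<1+n v))
                (filter-avoided E u∉E v∉E))

m-pathFrom-++ zero    _ _ = refl
m-pathFrom-++ (suc c) r   = m-pathEdges-++ c (n<1+n _) (AvoidsRange-head r) (AvoidsRange-tail r)

m-pathFrom : ∀ v c → m (pathFrom v c ++ []) ≗ pathPoly c
m-pathFrom v c i = trans (m-pathFrom-++ c (λ _ _ → []) i) (pathMul-cong c m-[] i)

m-pathEdges : ∀ u {v} c → u < v → m (pathEdges u v c ++ []) ≗ pathPoly (suc c)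
m-pathEdges u c u<v i = trans (m-pathEdges-++ c u<v [] (λ _ _ → []) i) (pathMul-cong (suc c) m-[] i)

-- In P (2 ∷ suc a ∷ b ∷ []) the centre is 0, the short arm is 0–1–2, and the other arms are
-- 0–3–…–(a+3) and 0–(a+4)–…–(a+b+3).
module _ (a b : ℕ) where
  private
    arm tail arms : List Edge
    arm  = pathEdges 0 (4 + a) b ++ []
    tail = pathFrom (4 + a) b ++ []
    arms = pathEdges 0 3 (suc a) ++ arm

    3<4+a : 3 < 4 + a
    3<4+a = s≤s (s≤s (s≤s z<s))

    arm-avoids : ∀ {x} → 0 < x → x < 4 + a → Avoids x arm
    arm-avoids 0<x x<4+a = All.++⁺ (avoids-pathEdges b (≢-sym (<⇒≢ 0<x)) x<4+a) []

    tail-avoids : ∀ {x} → x < 4 + a → Avoids x tail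
    tail-avoids x<4+a = All.++⁺ (avoids-pathFrom b x<4+a) []

    arms-avoids : ∀ {x} → 0 < x → x < 3 → Avoids x arms
    arms-avoids 0<x x<3 =
      All.++⁺ (avoids-pathEdges (suc a) (≢-sym (<⇒≢ 0<x)) x<3) (arm-avoids 0<x (<-trans x<3 3<4+a))

    filter-arm : ∀ {y} → y < 4 + a → filterᵇ (disjointᵇ (0 , y)) arm ≡ tail
    filter-arm {y} y<4+a = trans (filter-++ (T? ∘ disjointᵇ (0 , y)) (pathEdges 0 (4 + a) b) [])
      (cong (_++ []) (filter-pathEdges 0 (4 + a) b refl z<s y<4+a))

    m-3-tail : m (pathEdges 3 4 a ++ tail) ≗ pathMul (suc a) (pathPoly b)
    m-3-tail i = trans (m-pathEdges-++ a (n<1+n 3) (tail-avoids 3<4+a) (λ _ → tail-avoids) i)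
                       (pathMul-cong (suc a) (m-pathFrom (4 + a) b) i)

    -- The long arms form a path, but their edges are not listed in path order: split at (0 , 3).
    m-arms : m arms ≗ pathPoly (suc (suc a + b))
    m-arms = m-ext arms (pathPoly-zero (suc (suc a + b))) λ i → begin
      m ((0 , 3) ∷ pathEdges 3 4 a ++ arm) (suc i)
        ≡⟨ m-delete (0 , 3) (pathEdges 3 4 a ++ arm) i ⟩
      m (pathEdges 3 4 a ++ arm) (suc i) + m (filterᵇ (disjointᵇ (0 , 3)) (pathEdges 3 4 a ++ arm)) i
        ≡⟨ cong₂ _+_ (m-3-arm (suc i)) (trans (cong (λ T → m T i) removed) (m-4-tail i)) ⟩
      pathMul (suc a) (pathPoly (suc b)) (suc i) + pathMul a (pathPoly b) i
        ≡⟨ pathPoly-join a b (suc i) ⟩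
      pathPoly (suc (suc a + b)) (suc i) ∎
      where
      open ≡-Reasoning
      m-3-arm : m (pathEdges 3 4 a ++ arm) ≗ pathMul (suc a) (pathPoly (suc b))
      m-3-arm i = trans (m-pathEdges-++ a (n<1+n 3) (arm-avoids z<s 3<4+a) (λ 4≤x → arm-avoids (<-trans z<s 4≤x)) i)
                        (pathMul-cong (suc a) (m-pathEdges 0 b z<s) i)
      removed : filterᵇ (disjointᵇ (0 , 3)) (pathEdges 3 4 a ++ arm) ≡ pathFrom 4 a ++ tail
      removed = trans (filter-++ (T? ∘ disjointᵇ (0 , 3)) (pathEdges 3 4 a) arm)
                      (cong₂ _++_ (filter-pathEdges 3 4 a refl z<s (n<1+n 3)) (filter-arm 3<4+a))
      m-4-tail : m (pathFrom 4 a ++ tail) ≗ pathMul a (pathPoly b)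
      m-4-tail i = trans (m-pathFrom-++ a (λ _ → tail-avoids) i) (pathMul-cong a (m-pathFrom (4 + a) b) i)

  m-spider : ∀ i → m (P (2 ∷ suc a ∷ b ∷ [])) (suc i)
    ≡ pathPoly (suc (suc a + b)) (suc i) + pathPoly (suc (suc a + b)) i + pathMul (suc a) (pathPoly b) i
  m-spider i = begin
    m ((0 , 1) ∷ (1 , 2) ∷ arms) (suc i)
      ≡⟨ m-delete (0 , 1) ((1 , 2) ∷ arms) i ⟩
    m ((1 , 2) ∷ arms) (suc i) + m (filterᵇ (disjointᵇ (0 , 1)) arms) i
      ≡⟨ cong₂ _+_ (m-delete (1 , 2) arms i) (cong (λ T → m T i) removed) ⟩
    (m arms (suc i) + m (filterᵇ (disjointᵇ (1 , 2)) arms) i) + m (pathEdges 3 4 a ++ tail) i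
      ≡⟨ cong₂ _+_ (cong (λ T → m arms (suc i) + m T i) (filter-avoided arms (arms-avoids z<s 1<3) (arms-avoids z<s 2<3)))
                   (m-3-tail i) ⟩
    (m arms (suc i) + m arms i) + pathMul (suc a) (pathPoly b) i
      ≡⟨ cong (_+ pathMul (suc a) (pathPoly b) i) (cong₂ _+_ (m-arms (suc i)) (m-arms i)) ⟩
    pathPoly (suc (suc a + b)) (suc i) + pathPoly (suc (suc a + b)) i + pathMul (suc a) (pathPoly b) i ∎
    where
    open ≡-Reasoning
    1<3 : 1 < 3
    1<3 = s≤s (s≤s z≤n)
    2<3 : 2 < 3
    2<3 = n<1+n 2
    removed : filterᵇ (disjointᵇ (0 , 1)) arms ≡ pathEdges 3 4 a ++ tail
    removed = trans (filter-++ (T? ∘ disjointᵇ (0 , 1)) (pathEdges 0 3 (suc a)) arm)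
                    (cong₂ _++_ (filter-pathEdges 0 3 (suc a) refl z<s 1<3) (filter-arm (<-trans 1<3 3<4+a)))

-- Comparing the trees of S_n

≺-of-gap : ∀ {T T′} (d : Poly) j → (∀ i → m T (suc i) ≡ m T′ (suc i) + d i) → 0 < d j → T′ ≺ T
≺-of-gap {T} {T′} d j gap 0<dj = weak , (suc j , strict)
  where
  weak : ∀ i → m T′ i ≤ m T i
  weak zero    = ≤-reflexive (trans (m-zero T′) (sym (m-zero T)))
  weak (suc i) = subst (m T′ (suc i) ≤_) (sym (gap i)) (m≤m+n (m T′ (suc i)) (d i))
  strict : m T′ (suc j) < m T (suc j)
  strict = subst (m T′ (suc j) <_) (sym (gap j)) (m<m+n (m T′ (suc j)) 0<dj)

P2-≡ : ∀ n {a b} → suc a + b ≡ n ∸ 3 → P2 n (suc a) ≡ P (2 ∷ suc a ∷ b ∷ [])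
P2-≡ n {a} {b} a+b≡N = cong (λ c → P (2 ∷ suc a ∷ c ∷ [])) (trans (cong (_∸ suc a) (sym a+b≡N)) (m+n∸m≡n (suc a) b))

m-P2 : ∀ n {a b} → suc a + b ≡ n ∸ 3 → ∀ i →
  m (P2 n (suc a)) (suc i) ≡ pathPoly (suc (n ∸ 3)) (suc i) + pathPoly (suc (n ∸ 3)) i + pathMul (suc a) (pathPoly b) i
m-P2 n {a} {b} a+b≡N i = begin
  m (P2 n (suc a)) (suc i)
    ≡⟨ cong (λ T → m T (suc i)) (P2-≡ n {a} {b} a+b≡N) ⟩
  m (P (2 ∷ suc a ∷ b ∷ [])) (suc i)
    ≡⟨ m-spider a b i ⟩
  pathPoly (suc (suc a + b)) (suc i) + pathPoly (suc (suc a + b)) i + pathMul (suc a) (pathPoly b) i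
    ≡⟨ cong (λ N → pathPoly (suc N) (suc i) + pathPoly (suc N) i + pathMul (suc a) (pathPoly b) i) a+b≡N ⟩
  pathPoly (suc (n ∸ 3)) (suc i) + pathPoly (suc (n ∸ 3)) i + pathMul (suc a) (pathPoly b) i ∎
  where open ≡-Reasoning

≻-of-pathMul : ∀ n a a′ {b b′} j c → suc a + b ≡ n ∸ 3 → suc a′ + b′ ≡ n ∸ 3 →
  pathMul (suc a) (pathPoly b) ≗ pathMul (suc a′) (pathPoly b′) ⊕ shiftBy j (pathPoly c) →
  P2 n (suc a) ≻ P2 n (suc a′)
≻-of-pathMul n a a′ {b} {b′} j c a+b≡N a′+b′≡N products =
  ≺-of-gap {P2 n (suc a)} {P2 n (suc a′)} (shiftBy j (pathPoly c)) j gap positive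
  where
  gap : ∀ i → m (P2 n (suc a)) (suc i) ≡ m (P2 n (suc a′)) (suc i) + shiftBy j (pathPoly c) i
  gap i = begin
    m (P2 n (suc a)) (suc i)                       ≡⟨ m-P2 n {a} {b} a+b≡N i ⟩
    B + pathMul (suc a) (pathPoly b) i             ≡⟨ cong (B +_) (products i) ⟩
    B + (pathMul (suc a′) (pathPoly b′) i + D)     ≡⟨ +-assoc B (pathMul (suc a′) (pathPoly b′) i) D ⟨
    B + pathMul (suc a′) (pathPoly b′) i + D       ≡⟨ cong (_+ D) (m-P2 n {a′} {b′} a′+b′≡N i) ⟨
    m (P2 n (suc a′)) (suc i) + D ∎
    where
    open ≡-Reasoning
    B = pathPoly (suc (n ∸ 3)) (suc i) + pathPoly (suc (n ∸ 3)) i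
    D = shiftBy j (pathPoly c) i
  positive : 0 < shiftBy j (pathPoly c) j
  positive rewrite shiftBy-diag j (pathPoly c) | pathPoly-zero c = z<s

x+[2+x+d]≡[1+x]+[1+x]+d : ∀ x d → x + (suc (suc x) + d) ≡ (suc x + suc x) + d
x+[2+x+d]≡[1+x]+[1+x]+d = solve-∀

x+[2+x+[2+c]]≡[2+x]+[2+x]+c : ∀ x c → x + (suc (suc x) + suc (suc c)) ≡ (suc (suc x) + suc (suc x)) + c
x+[2+x+[2+c]]≡[2+x]+[2+x]+c = solve-∀

module Slack (n L : ℕ) (2L≤N : L + L ≤ n ∸ 3) where
  slack : ℕ
  slack = n ∸ 3 ∸ (L + L)

  2L+slack≡N : L + L + slack ≡ n ∸ 3
  2L+slack≡N = m+[n∸m]≡n 2L≤N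

  L+[L+slack]≡N : L + (L + slack) ≡ n ∸ 3
  L+[L+slack]≡N = trans (sym (+-assoc L L slack)) 2L+slack≡N

≻-even-step : ∀ n j → let L = double (suc (suc j)) in
  L + L ≤ n ∸ 3 → P2 n (double (suc j)) ≻ P2 n L
≻-even-step n j 2L≤N =
  ≻-of-pathMul n (suc (double j)) (suc (double (suc j))) (suc (double (suc j))) (suc slack)
    (trans (x+[2+x+[2+c]]≡[2+x]+[2+x]+c (double (suc j)) slack) 2L+slack≡N) L+[L+slack]≡N (pathPoly-step-even (suc j) slack)
  where open Slack n (double (suc (suc j))) 2L≤N

≻-odd-step : ∀ n j → let L = suc (double (suc j)) in
  L + L ≤ n ∸ 3 → P2 n L ≻ P2 n (suc (double j))
≻-odd-step n j 2L≤N =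
  ≻-of-pathMul n (double (suc j)) (double j) (suc (suc (double j))) (suc slack)
    L+[L+slack]≡N (trans (x+[2+x+[2+c]]≡[2+x]+[2+x]+c (suc (double j)) slack) 2L+slack≡N) (pathPoly-step-odd j slack)
  where open Slack n (suc (double (suc j))) 2L≤N

≻-even-pred : ∀ n t → let L = double (suc t) in
  L + L ≤ n ∸ 3 → P2 n L ≻ P2 n (suc (double t))
≻-even-pred n t 2L≤N =
  ≻-of-pathMul n (suc (double t)) (double t) (suc (suc (double t))) slack
    L+[L+slack]≡N (trans (x+[2+x+d]≡[1+x]+[1+x]+d (suc (double t)) slack) 2L+slack≡N) (pathPoly-exchange-odd t slack)
  where open Slack n (double (suc t)) 2L≤N

≻-even-succ : ∀ n t → let L = suc (double (suc t)) in
  L + L ≤ n ∸ 3 → P2 n (double (suc t)) ≻ P2 n L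
≻-even-succ n t 2L≤N =
  ≻-of-pathMul n (suc (double t)) (double (suc t)) (suc (double (suc t))) slack
    (trans (x+[2+x+d]≡[1+x]+[1+x]+d (double (suc t)) slack) 2L+slack≡N) L+[L+slack]≡N (pathPoly-exchange-even (suc t) slack)
  where open Slack n (suc (double (suc t))) 2L≤N

double≡2* : ∀ x → double x ≡ 2 * x
double≡2* zero    = refl
double≡2* (suc x) = trans (cong (suc ∘ suc) (double≡2* x)) (sym (*-suc 2 x))

double-mono-≤ : ∀ {x y} → x ≤ y → double x ≤ double y
double-mono-≤ z≤n       = z≤n
double-mono-≤ (s≤s x≤y) = s≤s (s≤s (double-mono-≤ x≤y))

double-/2 : ∀ t → double t / 2 ≡ t
double-/2 zero    = refl
double-/2 (suc t) = trans (m/n≡1+[m∸n]/n {double (suc t)} {2} (s≤s (s≤s z≤n))) (cong suc (double-/2 t))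

suc-double-/2 : ∀ t → suc (double t) / 2 ≡ t
suc-double-/2 zero    = refl
suc-double-/2 (suc t) = trans (m/n≡1+[m∸n]/n {suc (double (suc t))} {2} (s≤s (s≤s z≤n))) (cong suc (suc-double-/2 t))

parity : ∀ k → (∃ λ t → k ≡ double t) ⊎ (∃ λ t → k ≡ suc (double t))
parity zero = inj₁ (0 , refl)
parity (suc k) with parity k
... | inj₁ (t , refl) = inj₂ (t , refl)
... | inj₂ (t , refl) = inj₁ (suc t , refl)

Linked-applyUpTo-++ : ∀ {A : Set} {R : A → A → Set} (f : ℕ → A) t {y ys} →
  (∀ {i} → i < t → R (f i) (f (suc i))) → R (f t) y → Linked R (y ∷ ys) →
  Linked R (applyUpTo f (suc t) ++ y ∷ ys)
Linked-applyUpTo-++ f zero    steps fRy Ly = fRy ∷ Ly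
Linked-applyUpTo-++ f (suc t) steps fRy Ly = steps z<s ∷ Linked-applyUpTo-++ (f ∘ suc) t (steps ∘ s≤s) fRy Ly

chain-even : ∀ n t → let k = double (suc t) in k + k ≤ n ∸ 3 →
  Linked (λ a a′ → P2 n a ≻ P2 n a′) (applyUpTo (double ∘ suc) (suc t) ++ applyDownFrom (suc ∘ double) (suc t))
chain-even n t 2k≤N = Linked-applyUpTo-++ (double ∘ suc) t
  (λ i<t → ≻-even-step n _ (fits (double-mono-≤ (s≤s i<t))))
  (≻-even-pred n t (fits ≤-refl))
  (applyDownFrom⁺₁ (suc ∘ double) (suc t) λ { (s≤s i<t) → ≻-odd-step n _ (fits (s≤s (m≤n⇒m≤1+n (double-mono-≤ i<t)))) })
  where
  fits : ∀ {L} → L ≤ double (suc t) → L + L ≤ n ∸ 3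
  fits L≤k = ≤-trans (+-mono-≤ L≤k L≤k) 2k≤N

chain-odd : ∀ n t → let k = suc (double t) in k + k ≤ n ∸ 3 →
  Linked (λ a a′ → P2 n a ≻ P2 n a′) (applyUpTo (double ∘ suc) t ++ applyDownFrom (suc ∘ double) (suc t))
chain-odd n zero    _    = [-]
chain-odd n (suc t) 2k≤N = Linked-applyUpTo-++ (double ∘ suc) t
  (λ i<t → ≻-even-step n _ (fits (m≤n⇒m≤1+n (double-mono-≤ (s≤s i<t)))))
  (≻-even-succ n t (fits ≤-refl))
  (applyDownFrom⁺₁ (suc ∘ double) (suc (suc t)) λ { (s≤s i<1+t) → ≻-odd-step n _ (fits (s≤s (double-mono-≤ i<1+t))) })
  where
  fits : ∀ {L} → L ≤ suc (double (suc t)) → L + L ≤ n ∸ 3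
  fits L≤k = ≤-trans (+-mono-≤ L≤k L≤k) 2k≤N

chain-linked : ∀ n k → k + k ≤ n ∸ 3 → 1 ≤ k →
  Linked (λ a a′ → P2 n a ≻ P2 n a′)
         (applyUpTo (double ∘ suc) (k / 2) ++ applyDownFrom (suc ∘ double) (suc ((k ∸ 1) / 2)))
chain-linked n k 2k≤N 1≤k with parity k
chain-linked n .0 _ () | inj₁ (zero , refl)
... | inj₁ (suc t , refl) rewrite double-/2 (suc t) | suc-double-/2 t = chain-even n t 2k≤N
... | inj₂ (t , refl)     rewrite suc-double-/2 t | double-/2 t       = chain-odd n t 2k≤N

chainIndices-≡ : ∀ t l →
  map (λ j → 2 * suc j) (upTo t) ++ map (λ j → suc (2 * j)) (reverse (upTo (suc l)))
    ≡ applyUpTo (double ∘ suc) t ++ applyDownFrom (suc ∘ double) (suc l)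
chainIndices-≡ t l = cong₂ _++_
  (trans (map-cong (λ j → sym (double≡2* (suc j))) (upTo t)) (map-upTo (double ∘ suc) t))
  (trans (cong (map _) (reverse-upTo (suc l)))
    (trans (map-cong (λ j → cong suc (sym (double≡2* j))) (downFrom (suc l))) (map-downFrom (suc ∘ double) (suc l))))

half+half≤ : ∀ N → N / 2 + N / 2 ≤ N
half+half≤ N = subst (_≤ N) (trans (*-comm (N / 2) 2) (cong (N / 2 +_) (+-identityʳ (N / 2)))) (m/n*n≤m N 2)

theorem5p1 : (n : ℕ) → 5 ≤ n →
    Linked (λ a a′ → P2 n a ≻ P2 n a′) (chainIndices n)
theorem5p1 n 5≤n =
  subst (Linked _) (sym (chainIndices-≡ (k / 2) ((k ∸ 1) / 2)))
        (chain-linked n k (half+half≤ (n ∸ 3)) (m≥n⇒m/n>0 (∸-monoˡ-≤ 3 5≤n)))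
  where
  k = (n ∸ 3) / 2
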